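{- Let $T\subseteq K_n^{(d)}$ be a (spanning) $d$-hypertree with nonnegative weights $w:T\to\mathbb{R}_{\ge0}$. Then the induced $d$-volume function $v_T$ is an $\ell_1$ $d$-volume.
   Context: $V$ is a finite set, $|V|=n$; $K_n^{(d)}$ is the set of $(d+1)$-subsets of $V$. Let $M_d$ be the $\mathbb{Z}_2$-incidence matrix between $(d-1)$-simplices (rows) and $d$-simplices (columns), $M_d(\tau,\sigma)=1$ iff $\tau\subset\sigma$. A $d$-cycle is $Z\subseteq K_n^{(d)}$ with $M_d1_Z=0$ over $\mathbb{Z}_2$. A $d$-hypertree is a maximal subset of $K_n^{(d)}$ containing no nonempty $d$-cycle. For a subset $X\subseteq K_n^{(d)}$ containing a $d$-hypertree and with nonnegative weights $w$, the induced volume is $v_X(\sigma)=\min_{D}\sum_{\sigma'\in D}w(\sigma')$ over all $\sigma$-caps $D\subseteq X$, i.e. sets $D\subseteq X$ such that the symmetric difference $D\triangle\{\sigma\}$ is a $d$-cycle (so $D=\{\sigma\}$ is allowed when $\sigma\in X$). For $A\subseteq K_n^{(d)}$, $\sigma$ is null homologous relative to $A$ if $1_{\{\sigma\}}$ lies in the $\mathbb{Z}_2$-span of the columns of $M_d$ indexed by $A$; $\sigma_1\sim\sigma_2\bmod A$ if $1_{\{\sigma_1\}}-1_{\{\sigma_2\}}$ does. A $d$-hypercut is a nonempty $C$ with no element null homologous relative to $K_n^{(d)}\setminus C$ and all elements pairwise $\sim\bmod(K_n^{(d)}\setminus C)$. Its cut volume $v_C$ is the indicator of $C$; an $\ell_1$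 $d$-volume is a nonnegative combination of cut volumes. -}

module Defs where

open import Data.Nat using (ℕ; zero; suc; _≟_)
open import Data.Bool using (Bool; true; false; _xor_; _∧_; not; if_then_else_)
open import Data.List using (List; []; _∷_; _++_; map; filter; foldr)
open import Data.Vec using (Vec; []; _∷_)
open import Data.Vec.Properties using (≡-dec)
open import Data.Fin.Subset using (Subset; outside; inside; ∣_∣)
open import Data.Fin.Subset.Properties using (_⊆?_)
open import Data.Unit using (⊤)
open import Data.Product using (Σ; ∃; _×_; _,_)
open import Relation.Nullary using (¬_)
open import Relation.Nullary.Decidable using (⌊_⌋)
open import Relation.Binary.PropositionalEquality using (_≡_)
open import Relation.Binary.Structures using (IsTotalOrder)
open import Algebra.Structures using (IsCommutativeMonoid)
import Data.Bool as B

-- Scalars: an abstract totally ordered commutative monoid in which every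
-- element is ≥ 0 and addition is monotone.  (ℝ≥0 with +, ≤ is an
-- instance; the stdlib has no real numbers.)  Weights and the
-- coefficients of ℓ₁ volumes range over such a structure.

record NonNegScalars : Set₁ where
  infixl 6 _+_
  infix  4 _≤_
  field
    Carrier : Set
    0#      : Carrier
    _+_     : Carrier → Carrier → Carrier
    _≤_     : Carrier → Carrier → Set
    isCommutativeMonoid : IsCommutativeMonoid _≡_ _+_ 0#
    isTotalOrder        : IsTotalOrder _≡_ _≤_
    +-mono-≤ : ∀ {a b c e} → a ≤ b → c ≤ e → a + c ≤ b + e
    0≤x      : ∀ x → 0# ≤ x

-- Vertex set V = Fin n; a simplex is a vertex subset (Subset n).
-- A family of simplices is a Boolean predicate on vertex subsets.

Family : ℕ → Set
Family n = Subset n → Bool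

allSubsets : (n : ℕ) → List (Subset n)
allSubsets zero    = [] ∷ []
allSubsets (suc n) = map (outside ∷_) (allSubsets n) ++ map (inside ∷_) (allSubsets n)

K : (n d : ℕ) → Family n
K n d s = ⌊ ∣ s ∣ ≟ suc d ⌋

simplices : (n d : ℕ) → List (Subset n)
simplices n d = filter (λ s → ∣ s ∣ ≟ suc d) (allSubsets n)

_⊆F_ : ∀ {n} → Family n → Family n → Set
A ⊆F B = ∀ s → A s ≡ true → B s ≡ true

_△_ : ∀ {n} → Family n → Family n → Family n
(A △ B) s = A s xor B s

_∖_ : ∀ {n} → Family n → Family n → Family n
(A ∖ B) s = A s ∧ not (B s)

single : ∀ {n} → Subset n → Family n
single σ s = ⌊ ≡-dec B._≟_ s σ ⌋

empty : ∀ {n} → Family n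
empty _ = false

NonEmpty : (n d : ℕ) → Family n → Set
NonEmpty n d Z = ∃ λ σ → K n d σ ≡ true × Z σ ≡ true

-- Boundary over ℤ₂: (M_d 1_Z)(τ) = parity of #{σ ∈ Z ∩ K_n^(d) : τ ⊆ σ}

boundary : (n d : ℕ) → Family n → Subset n → Bool
boundary n d Z τ = foldr _xor_ false (map (λ σ → Z σ ∧ ⌊ τ ⊆? σ ⌋) (simplices n d))

Cycle : (n d : ℕ) → Family n → Set
Cycle n d Z = (Z ⊆F K n d) × (∀ τ → ∣ τ ∣ ≡ d → boundary n d Z τ ≡ false)

Acyclic : (n d : ℕ) → Family n → Set
Acyclic n d X = ∀ Z → Z ⊆F X → Cycle n d Z → ¬ NonEmpty n d Z

Hypertree : (n d : ℕ) → Family n → Set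
Hypertree n d T =
  (T ⊆F K n d) × Acyclic n d T ×
  (∀ X → T ⊆F X → X ⊆F K n d → Acyclic n d X → X ⊆F T)

module _ (R : NonNegScalars) where
  open NonNegScalars R

  weight : (n d : ℕ) → (Subset n → Carrier) → Family n → Carrier
  weight n d w D = foldr _+_ 0# (map (λ σ → if D σ then w σ else 0#) (simplices n d))

  Cap : (n d : ℕ) → Family n → Subset n → Family n → Set
  Cap n d X σ D = (D ⊆F X) × Cycle n d (D △ single σ)

  IsInducedVolume : (n d : ℕ) → Family n → (Subset n → Carrier) → (Subset n → Carrier) → Set
  IsInducedVolume n d X w v =
    ∀ σ → K n d σ ≡ true →
      (∃ λ D → Cap n d X σ D × v σ ≡ weight n d w D) ×
      (∀ D → Cap n d X σ D → v σ ≤ weight n d w D)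

-- 1_{σ} (more precisely its boundary column) is in the ℤ₂-span of the columns indexed by A
NullHomologous : (n d : ℕ) → Family n → Subset n → Set
NullHomologous n d A σ = ∃ λ D → (D ⊆F A) × Cycle n d (D △ single σ)

Homologous : (n d : ℕ) → Family n → Subset n → Subset n → Set
Homologous n d A σ₁ σ₂ = ∃ λ D → (D ⊆F A) × Cycle n d ((D △ single σ₁) △ single σ₂)

Hypercut : (n d : ℕ) → Family n → Set
Hypercut n d C =
  (C ⊆F K n d) × NonEmpty n d C ×
  (∀ σ → C σ ≡ true → ¬ NullHomologous n d (K n d ∖ C) σ) ×
  (∀ σ₁ σ₂ → C σ₁ ≡ true → C σ₂ ≡ true → Homologous n d (K n d ∖ C) σ₁ σ₂)

module _ (R : NonNegScalars) where
  open NonNegScalars R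

  combination : ∀ {n} → List (Family n × Carrier) → Subset n → Carrier
  combination cs σ = foldr _+_ 0# (map (λ { (C , λc) → if C σ then λc else 0# }) cs)

  AllHypercuts : (n d : ℕ) → List (Family n × Carrier) → Set
  AllHypercuts n d []             = ⊤
  AllHypercuts n d ((C , _) ∷ cs) = Hypercut n d C × AllHypercuts n d cs

  IsL1Volume : (n d : ℕ) → (Subset n → Carrier) → Set
  IsL1Volume n d v =
    ∃ λ (cs : List (Family n × Carrier)) →
      AllHypercuts n d cs × (∀ σ → K n d σ ≡ true → v σ ≡ combination cs σ)

module Submission where

-- Let T ⊆ K_n^(d) be acyclic and choose for every d-simplex ρ a ρ-cap
-- cap ρ ⊆ T.  Summing caps is a chain map on d-cycles: the ℤ₂-sum of the
-- caps of the simplices of a cycle Z is a chain in T with boundary ∂Z = 0,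
-- hence a cycle in T, hence zero by acyclicity.  Consequently, for τ ∈ T,
-- the fundamental cut C_τ = {ρ : τ ∈ cap ρ} is a d-hypercut: a relation
-- D + σ = cycle with D off C_τ and σ ∈ C_τ would sum to a chain containing τ,
-- while two members σ₁, σ₂ of C_τ are homologous via cap σ₁ + cap σ₂.
-- Finally v σ = w(cap σ) = Σ_{τ ∈ T} w τ · 1_{C_τ}(σ), an ℓ₁ volume.

open import Defs
open import Data.Nat using (ℕ; zero; suc; _≟_)
open import Data.Bool using (Bool; true; false; _xor_; _∧_; not; if_then_else_)
open import Data.Bool.Properties
  using ( xor-∧-commutativeRing; xor-assoc; xor-identityʳ
        ; ∧-assoc; ∧-comm; ∧-zeroʳ; ∧-conicalˡ; ∧-conicalʳ; ∧-distribʳ-xor )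
open import Data.Bool using () renaming (_≟_ to _≟ᵇ_)
open import Data.Fin.Subset using (Subset; outside; inside; ∣_∣)
open import Data.Fin.Subset.Properties using (_⊆?_)
open import Data.Vec using ([]; _∷_)
open import Data.Vec.Properties using (≡-dec)
open import Data.List using (List; []; _∷_; _++_; map; filter; foldr)
open import Data.Product using (_×_; _,_; proj₁; proj₂)
open import Data.Sum using (_⊎_; inj₁; inj₂)
open import Data.Empty using (⊥-elim)
open import Relation.Nullary using (¬_)
open import Relation.Nullary.Decidable using (isYes; yes; no; _because_)
open import Relation.Unary using (Pred; Decidable)
open import Relation.Binary.PropositionalEquality
open import Algebra.Bundles using (CommutativeRing; CommutativeMonoid)
open import Algebra.Structures using (IsCommutativeMonoid)
open import Algebra.Properties.CommutativeSemigroup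
  (CommutativeMonoid.commutativeSemigroup (CommutativeRing.+-commutativeMonoid xor-∧-commutativeRing))
  using (interchange)

open ≡-Reasoning

variable
  A B : Set

xor≡true : ∀ a b → a xor b ≡ true → a ≡ true ⊎ b ≡ true
xor≡true true  _ _ = inj₁ refl
xor≡true false _ e = inj₂ e

xor≡false : ∀ a b → a xor b ≡ false → a ≡ b
xor≡false true  true  _ = refl
xor≡false false false _ = refl

true≢false : true ≢ false
true≢false ()

∧-not-∧ : ∀ a b → a ∧ not (a ∧ b) ≡ true → b ≡ false
∧-not-∧ true false _ = refl

parity : List A → (A → Bool) → Bool
parity l f = foldr _xor_ false (map f l)

parity-cong : (l : List A) {f g : A → Bool} → (∀ x → f x ≡ g x) → parity l f ≡ parity l g
parity-cong []      _ = refl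
parity-cong (x ∷ l) h = cong₂ _xor_ (h x) (parity-cong l h)

parity-zero : (l : List A) {f : A → Bool} → (∀ x → f x ≡ false) → parity l f ≡ false
parity-zero []      _ = refl
parity-zero (x ∷ l) h = cong₂ _xor_ (h x) (parity-zero l h)

parity-xor : (l : List A) (f g : A → Bool) →
             parity l (λ x → f x xor g x) ≡ parity l f xor parity l g
parity-xor []      f g = refl
parity-xor (x ∷ l) f g = begin
  (f x xor g x) xor parity l (λ y → f y xor g y)  ≡⟨ cong ((f x xor g x) xor_) (parity-xor l f g) ⟩
  (f x xor g x) xor (parity l f xor parity l g)   ≡⟨ interchange (f x) (g x) (parity l f) (parity l g) ⟩
  parity (x ∷ l) f xor parity (x ∷ l) g           ∎

parity-∧ˡ : (l : List A) (b : Bool) (f : A → Bool) → parity l (λ x → b ∧ f x) ≡ b ∧ parity l f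
parity-∧ˡ l true  f = refl
parity-∧ˡ l false f = parity-zero l (λ _ → refl)

parity-∧ʳ : (l : List A) (f : A → Bool) (b : Bool) → parity l (λ x → f x ∧ b) ≡ parity l f ∧ b
parity-∧ʳ l f b = begin
  parity l (λ x → f x ∧ b)  ≡⟨ parity-cong l (λ x → ∧-comm (f x) b) ⟩
  parity l (λ x → b ∧ f x)  ≡⟨ parity-∧ˡ l b f ⟩
  b ∧ parity l f            ≡⟨ ∧-comm b _ ⟩
  parity l f ∧ b            ∎

parity-++ : (l₁ l₂ : List A) (f : A → Bool) → parity (l₁ ++ l₂) f ≡ parity l₁ f xor parity l₂ f
parity-++ []       l₂ f = refl
parity-++ (x ∷ l₁) l₂ f = trans (cong (f x xor_) (parity-++ l₁ l₂ f)) (sym (xor-assoc (f x) _ _))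

parity-map : (h : A → B) (l : List A) (f : B → Bool) → parity (map h l) f ≡ parity l (λ x → f (h x))
parity-map h []      f = refl
parity-map h (x ∷ l) f = cong (f (h x) xor_) (parity-map h l f)

parity-filter : ∀ {p} {P : Pred A p} (P? : Decidable P) (l : List A) (f : A → Bool) →
                parity (filter P? l) f ≡ parity l (λ x → isYes (P? x) ∧ f x)
parity-filter P? []      f = refl
parity-filter P? (x ∷ l) f with P? x
... | true  because _ = cong (f x xor_) (parity-filter P? l f)
... | false because _ = parity-filter P? l f

parity-swap : (l₁ : List A) (l₂ : List B) (g : A → B → Bool) →
              parity l₁ (λ x → parity l₂ (g x)) ≡ parity l₂ (λ y → parity l₁ (λ x → g x y))
parity-swap []       l₂ g = sym (parity-zero l₂ (λ _ → refl))
parity-swap (x ∷ l₁) l₂ g =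
  trans (cong (parity l₂ (g x) xor_) (parity-swap l₁ l₂ g))
        (sym (parity-xor l₂ (g x) (λ y → parity l₁ (λ x′ → g x′ y))))

single-∷ : ∀ {n} x y (σ ρ : Subset n) → single (x ∷ σ) (y ∷ ρ) ≡ isYes (y ≟ᵇ x) ∧ single σ ρ
single-∷ false false σ ρ with ≡-dec _≟ᵇ_ ρ σ
... | yes _ = refl
... | no  _ = refl
single-∷ false true  σ ρ = refl
single-∷ true  false σ ρ = refl
single-∷ true  true  σ ρ with ≡-dec _≟ᵇ_ ρ σ
... | yes _ = refl
... | no  _ = refl

single≡true : ∀ {n} (σ s : Subset n) → single σ s ≡ true → s ≡ σ
single≡true σ s e with ≡-dec _≟ᵇ_ s σ
... | yes s≡σ = s≡σ

single-self : ∀ {n} (σ : Subset n) → single σ σ ≡ true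
single-self σ with ≡-dec _≟ᵇ_ σ σ
... | yes _   = refl
... | no  σ≢σ = ⊥-elim (σ≢σ refl)

parity-allSubsets-suc : ∀ n (f : Subset (suc n) → Bool) →
  parity (allSubsets (suc n)) f ≡
  parity (allSubsets n) (λ ρ → f (outside ∷ ρ)) xor parity (allSubsets n) (λ ρ → f (inside ∷ ρ))
parity-allSubsets-suc n f = begin
  parity (map (outside ∷_) S ++ map (inside ∷_) S) f
    ≡⟨ parity-++ (map (outside ∷_) S) (map (inside ∷_) S) f ⟩
  parity (map (outside ∷_) S) f xor parity (map (inside ∷_) S) f
    ≡⟨ cong₂ _xor_ (parity-map (outside ∷_) S f) (parity-map (inside ∷_) S f) ⟩
  parity S (λ ρ → f (outside ∷ ρ)) xor parity S (λ ρ → f (inside ∷ ρ)) ∎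
  where
  S : List (Subset n)
  S = allSubsets n

parity-allSubsets-single : ∀ n (σ : Subset n) (b : Subset n → Bool) →
  parity (allSubsets n) (λ ρ → single σ ρ ∧ b ρ) ≡ b σ
parity-allSubsets-single zero    []      b = xor-identityʳ (b [])
parity-allSubsets-single (suc n) (x ∷ σ) b = begin
  parity (allSubsets (suc n)) (λ ρ → single (x ∷ σ) ρ ∧ b ρ)
    ≡⟨ parity-allSubsets-suc n _ ⟩
  parity S (λ ρ → single (x ∷ σ) (false ∷ ρ) ∧ b (false ∷ ρ)) xor
  parity S (λ ρ → single (x ∷ σ) (true ∷ ρ) ∧ b (true ∷ ρ))
    ≡⟨ cong₂ _xor_ (parity-cong S (λ ρ → cong (_∧ b (false ∷ ρ)) (single-∷ x false σ ρ)))
                   (parity-cong S (λ ρ → cong (_∧ b (true ∷ ρ)) (single-∷ x true σ ρ))) ⟩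
  parity S (λ ρ → (isYes (false ≟ᵇ x) ∧ single σ ρ) ∧ b (false ∷ ρ)) xor
  parity S (λ ρ → (isYes (true ≟ᵇ x) ∧ single σ ρ) ∧ b (true ∷ ρ))
    ≡⟨ pick x ⟩
  b (x ∷ σ) ∎
  where
  S : List (Subset n)
  S = allSubsets n
  pick : ∀ x → parity S (λ ρ → (isYes (false ≟ᵇ x) ∧ single σ ρ) ∧ b (false ∷ ρ)) xor
               parity S (λ ρ → (isYes (true ≟ᵇ x) ∧ single σ ρ) ∧ b (true ∷ ρ)) ≡ b (x ∷ σ)
  pick false = trans (cong₂ _xor_ (parity-allSubsets-single n σ (λ ρ → b (false ∷ ρ)))
                                  (parity-zero S (λ _ → refl)))
                     (xor-identityʳ _)
  pick true  = cong₂ _xor_ (parity-zero S (λ _ → refl))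
                           (parity-allSubsets-single n σ (λ ρ → b (true ∷ ρ)))

module Chains (n d : ℕ) where

  parity-simplices : (f : Subset n → Bool) →
                     parity (simplices n d) f ≡ parity (allSubsets n) (λ ρ → K n d ρ ∧ f ρ)
  parity-simplices = parity-filter (λ s → ∣ s ∣ ≟ suc d) (allSubsets n)

  parity-simplices-cong : {f g : Subset n → Bool} → (∀ ρ → K n d ρ ≡ true → f ρ ≡ g ρ) →
                          parity (simplices n d) f ≡ parity (simplices n d) g
  parity-simplices-cong {f} {g} f≡g = begin
    parity (simplices n d) f                    ≡⟨ parity-simplices f ⟩
    parity (allSubsets n) (λ ρ → K n d ρ ∧ f ρ) ≡⟨ parity-cong (allSubsets n) onK ⟩
    parity (allSubsets n) (λ ρ → K n d ρ ∧ g ρ) ≡⟨ parity-simplices g ⟨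
    parity (simplices n d) g                    ∎
    where
    onK : ∀ ρ → K n d ρ ∧ f ρ ≡ K n d ρ ∧ g ρ
    onK ρ with K n d ρ in k
    ... | true  = f≡g ρ k
    ... | false = refl

  parity-simplices-single : (σ : Subset n) (b : Subset n → Bool) → K n d σ ≡ true →
                            parity (simplices n d) (λ ρ → single σ ρ ∧ b ρ) ≡ b σ
  parity-simplices-single σ b kσ = begin
    parity (simplices n d) (λ ρ → single σ ρ ∧ b ρ)
      ≡⟨ parity-simplices _ ⟩
    parity (allSubsets n) (λ ρ → K n d ρ ∧ (single σ ρ ∧ b ρ))
      ≡⟨ parity-cong (allSubsets n) (λ ρ → ∧-swap (K n d ρ) (single σ ρ) (b ρ)) ⟩
    parity (allSubsets n) (λ ρ → single σ ρ ∧ (K n d ρ ∧ b ρ))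
      ≡⟨ parity-allSubsets-single n σ (λ ρ → K n d ρ ∧ b ρ) ⟩
    K n d σ ∧ b σ
      ≡⟨ cong (_∧ b σ) kσ ⟩
    b σ ∎
    where
    ∧-swap : ∀ a b c → a ∧ (b ∧ c) ≡ b ∧ (a ∧ c)
    ∧-swap a b c = trans (sym (∧-assoc a b c)) (trans (cong (_∧ c) (∧-comm a b)) (∧-assoc b a c))

  boundary-△ : (P Q : Family n) (τ : Subset n) →
               boundary n d (P △ Q) τ ≡ boundary n d P τ xor boundary n d Q τ
  boundary-△ P Q τ =
    trans (parity-cong (simplices n d) (λ σ → ∧-distribʳ-xor (isYes (τ ⊆? σ)) (P σ) (Q σ)))
          (parity-xor (simplices n d) (λ σ → P σ ∧ isYes (τ ⊆? σ)) (λ σ → Q σ ∧ isYes (τ ⊆? σ)))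

  boundary-single : (σ τ : Subset n) → K n d σ ≡ true → boundary n d (single σ) τ ≡ isYes (τ ⊆? σ)
  boundary-single σ τ = parity-simplices-single σ (λ ρ → isYes (τ ⊆? ρ))

  cycle-△ : (P Q : Family n) → Cycle n d P → Cycle n d Q → Cycle n d (P △ Q)
  cycle-△ P Q (P⊆K , ∂P) (Q⊆K , ∂Q) = △⊆K , ∂P△Q
    where
    △⊆K : (P △ Q) ⊆F K n d
    △⊆K s e with xor≡true (P s) (Q s) e
    ... | inj₁ Ps = P⊆K s Ps
    ... | inj₂ Qs = Q⊆K s Qs
    ∂P△Q : ∀ τ → ∣ τ ∣ ≡ d → boundary n d (P △ Q) τ ≡ false
    ∂P△Q τ ∣τ∣ = trans (boundary-△ P Q τ) (cong₂ _xor_ (∂P τ ∣τ∣) (∂Q τ ∣τ∣))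

  cycle-cong : (P Q : Family n) → (∀ s → P s ≡ Q s) → Cycle n d P → Cycle n d Q
  cycle-cong P Q P≡Q (P⊆K , ∂P) =
    (λ s e → P⊆K s (trans (P≡Q s) e)) ,
    (λ τ ∣τ∣ → trans (parity-cong (simplices n d) (λ σ → cong (_∧ _) (sym (P≡Q σ)))) (∂P τ ∣τ∣))

  homologous-boundary : (P Q : Family n) → Cycle n d (P △ Q) →
                        ∀ τ → ∣ τ ∣ ≡ d → boundary n d P τ ≡ boundary n d Q τ
  homologous-boundary P Q (_ , ∂P△Q) τ ∣τ∣ =
    xor≡false _ _ (trans (sym (boundary-△ P Q τ)) (∂P△Q τ ∣τ∣))

  acyclic-cycle-zero : {T Z : Family n} → Acyclic n d T → Z ⊆F T → Cycle n d Z → ∀ s → Z s ≡ false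
  acyclic-cycle-zero {Z = Z} acyclic Z⊆T cycZ s with Z s in Zs
  ... | false = refl
  ... | true  = ⊥-elim (acyclic Z Z⊆T cycZ (s , proj₁ cycZ s Zs , Zs))

  acyclic-cap-of-member : {T D : Family n} {σ : Subset n} → Acyclic n d T → T σ ≡ true →
                          D ⊆F T → Cycle n d (D △ single σ) → ∀ s → D s ≡ single σ s
  acyclic-cap-of-member {T} {D} {σ} acyclic Tσ D⊆T cyc s =
    xor≡false _ _ (acyclic-cycle-zero acyclic D△σ⊆T cyc s)
    where
    D△σ⊆T : (D △ single σ) ⊆F T
    D△σ⊆T s e with xor≡true (D s) (single σ s) e
    ... | inj₁ Ds = D⊆T s Ds
    ... | inj₂ s=σ = subst (λ u → T u ≡ true) (sym (single≡true σ s s=σ)) Tσ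

-- Fundamental cuts.  Fix an acyclic T ⊆ K_n^(d) and, for every d-simplex ρ,
-- a ρ-cap  cap ρ ⊆ T  (its values off K_n^(d) are irrelevant).

module FundamentalCuts {n d : ℕ} (T : Family n) (T⊆K : T ⊆F K n d) (acyclic : Acyclic n d T)
    (cap : Subset n → Family n)
    (cap⊆T : ∀ ρ → K n d ρ ≡ true → cap ρ ⊆F T)
    (cap-cycle : ∀ ρ → K n d ρ ≡ true → Cycle n d (cap ρ △ single ρ)) where

  open Chains n d

  cap-member : ∀ ρ → T ρ ≡ true → ∀ s → cap ρ s ≡ single ρ s
  cap-member ρ Tρ = acyclic-cap-of-member acyclic Tρ (cap⊆T ρ (T⊆K ρ Tρ)) (cap-cycle ρ (T⊆K ρ Tρ))

  cap-offT : ∀ ρ s → K n d ρ ≡ true → T s ≡ false → cap ρ s ≡ false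
  cap-offT ρ s kρ Ts with cap ρ s in c
  ... | true  = ⊥-elim (true≢false (trans (sym (cap⊆T ρ kρ s c)) Ts))
  ... | false = refl

  capSum : Family n → Family n
  capSum Z s = parity (simplices n d) (λ ρ → Z ρ ∧ cap ρ s)

  capSum-△ : (P Q : Family n) (s : Subset n) → capSum (P △ Q) s ≡ capSum P s xor capSum Q s
  capSum-△ P Q s =
    trans (parity-cong (simplices n d) (λ ρ → ∧-distribʳ-xor (cap ρ s) (P ρ) (Q ρ)))
          (parity-xor (simplices n d) (λ ρ → P ρ ∧ cap ρ s) (λ ρ → Q ρ ∧ cap ρ s))

  capSum-single : ∀ σ → K n d σ ≡ true → ∀ s → capSum (single σ) s ≡ cap σ s
  capSum-single σ kσ s = parity-simplices-single σ (λ ρ → cap ρ s) kσ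

  capSum-offT : ∀ Z s → T s ≡ false → capSum Z s ≡ false
  capSum-offT Z s Ts = trans (parity-simplices-cong term) (parity-zero (simplices n d) (λ _ → refl))
    where
    term : ∀ ρ → K n d ρ ≡ true → Z ρ ∧ cap ρ s ≡ false
    term ρ kρ = trans (cong (Z ρ ∧_) (cap-offT ρ s kρ Ts)) (∧-zeroʳ (Z ρ))

  capSum⊆T : ∀ Z → capSum Z ⊆F T
  capSum⊆T Z s e with T s in Ts
  ... | true  = refl
  ... | false = ⊥-elim (true≢false (trans (sym e) (capSum-offT Z s Ts)))

  cap-boundary : ∀ ρ → K n d ρ ≡ true → ∀ τ → ∣ τ ∣ ≡ d → boundary n d (cap ρ) τ ≡ isYes (τ ⊆? ρ)
  cap-boundary ρ kρ τ ∣τ∣ =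
    trans (homologous-boundary (cap ρ) (single ρ) (cap-cycle ρ kρ) τ ∣τ∣) (boundary-single ρ τ kρ)

  capSum-boundary : ∀ Z τ → ∣ τ ∣ ≡ d → boundary n d (capSum Z) τ ≡ boundary n d Z τ
  capSum-boundary Z τ ∣τ∣ = begin
    parity S (λ σ → parity S (λ ρ → Z ρ ∧ cap ρ σ) ∧ face σ)
      ≡⟨ parity-cong S (λ σ → sym (parity-∧ʳ S (λ ρ → Z ρ ∧ cap ρ σ) (face σ))) ⟩
    parity S (λ σ → parity S (λ ρ → (Z ρ ∧ cap ρ σ) ∧ face σ))
      ≡⟨ parity-cong S (λ σ → parity-cong S (λ ρ → ∧-assoc (Z ρ) (cap ρ σ) (face σ))) ⟩
    parity S (λ σ → parity S (λ ρ → Z ρ ∧ (cap ρ σ ∧ face σ)))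
      ≡⟨ parity-swap S S (λ σ ρ → Z ρ ∧ (cap ρ σ ∧ face σ)) ⟩
    parity S (λ ρ → parity S (λ σ → Z ρ ∧ (cap ρ σ ∧ face σ)))
      ≡⟨ parity-cong S (λ ρ → parity-∧ˡ S (Z ρ) (λ σ → cap ρ σ ∧ face σ)) ⟩
    parity S (λ ρ → Z ρ ∧ boundary n d (cap ρ) τ)
      ≡⟨ parity-simplices-cong (λ ρ kρ → cong (Z ρ ∧_) (cap-boundary ρ kρ τ ∣τ∣)) ⟩
    parity S (λ ρ → Z ρ ∧ face ρ) ∎
    where
    S : List (Subset n)
    S = simplices n d
    face : Subset n → Bool
    face σ = isYes (τ ⊆? σ)

  capSum-cycle-vanishes : ∀ Z → Cycle n d Z → ∀ s → capSum Z s ≡ false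
  capSum-cycle-vanishes Z (_ , ∂Z) = acyclic-cycle-zero acyclic (capSum⊆T Z) cycle
    where
    cycle : Cycle n d (capSum Z)
    cycle = (λ s e → T⊆K s (capSum⊆T Z s e)) ,
            (λ τ ∣τ∣ → trans (capSum-boundary Z τ ∣τ∣) (∂Z τ ∣τ∣))

  fundamentalCut : Subset n → Family n
  fundamentalCut τ ρ = K n d ρ ∧ cap ρ τ

  cut⊆K : ∀ τ ρ → fundamentalCut τ ρ ≡ true → K n d ρ ≡ true
  cut⊆K τ ρ = ∧-conicalˡ (K n d ρ) (cap ρ τ)

  cut-cap : ∀ τ ρ → fundamentalCut τ ρ ≡ true → cap ρ τ ≡ true
  cut-cap τ ρ = ∧-conicalʳ (K n d ρ) (cap ρ τ)

  -- No member of C_τ bounds modulo the complement of C_τ: a relation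
  -- D + σ ≡ cycle with D off C_τ would give  0 = capSum (D + σ) τ = cap σ τ = 1.
  fundamentalCut-not-null : ∀ τ σ → fundamentalCut τ σ ≡ true →
                            ¬ NullHomologous n d (K n d ∖ fundamentalCut τ) σ
  fundamentalCut-not-null τ σ σ∈C (D , D⊆ , cyc) = true≢false (begin
    true                                ≡⟨ cut-cap τ σ σ∈C ⟨
    cap σ τ                             ≡⟨ capSum-single σ (cut⊆K τ σ σ∈C) τ ⟨
    capSum (single σ) τ                 ≡⟨ cong (_xor capSum (single σ) τ) capSum-D ⟨
    capSum D τ xor capSum (single σ) τ  ≡⟨ capSum-△ D (single σ) τ ⟨
    capSum (D △ single σ) τ             ≡⟨ capSum-cycle-vanishes (D △ single σ) cyc τ ⟩
    false                               ∎)
    where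
    capSum-D : capSum D τ ≡ false
    capSum-D = parity-zero (simplices n d) term
      where
      term : ∀ ρ → D ρ ∧ cap ρ τ ≡ false
      term ρ with D ρ in Dρ
      ... | true  = ∧-not-∧ (K n d ρ) (cap ρ τ) (D⊆ ρ Dρ)
      ... | false = refl

  -- Any two members σ₁, σ₂ of C_τ (τ ∈ T) are homologous modulo the
  -- complement, via cap σ₁ + cap σ₂: it lies in T, and avoids τ — the only
  -- simplex of T whose cap meets τ — because both caps contain τ.
  fundamentalCut-homologous : ∀ τ → T τ ≡ true → ∀ σ₁ σ₂ →
                              fundamentalCut τ σ₁ ≡ true → fundamentalCut τ σ₂ ≡ true →
                              Homologous n d (K n d ∖ fundamentalCut τ) σ₁ σ₂
  fundamentalCut-homologous τ Tτ σ₁ σ₂ σ₁∈C σ₂∈C = D , D⊆ , cycle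
    where
    k₁ : K n d σ₁ ≡ true
    k₁ = cut⊆K τ σ₁ σ₁∈C
    k₂ : K n d σ₂ ≡ true
    k₂ = cut⊆K τ σ₂ σ₂∈C
    D : Family n
    D = cap σ₁ △ cap σ₂

    D∌τ : D τ ≡ false
    D∌τ = cong₂ _xor_ (cut-cap τ σ₁ σ₁∈C) (cut-cap τ σ₂ σ₂∈C)

    D⊆T : D ⊆F T
    D⊆T s e with xor≡true (cap σ₁ s) (cap σ₂ s) e
    ... | inj₁ c₁ = cap⊆T σ₁ k₁ s c₁
    ... | inj₂ c₂ = cap⊆T σ₂ k₂ s c₂

    cap-misses-τ : ∀ s → D s ≡ true → cap s τ ≡ false
    cap-misses-τ s Ds with single s τ in τ=s
    ... | false = trans (cap-member s (D⊆T s Ds) τ) τ=s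
    ... | true  = ⊥-elim (true≢false (trans (sym Ds) (subst (λ u → D u ≡ false) (single≡true s τ τ=s) D∌τ)))

    D⊆ : D ⊆F (K n d ∖ fundamentalCut τ)
    D⊆ s Ds = cong₂ (λ a b → a ∧ not (a ∧ b)) (T⊆K s (D⊆T s Ds)) (cap-misses-τ s Ds)

    cycle : Cycle n d ((D △ single σ₁) △ single σ₂)
    cycle = cycle-cong _ _ regroup (cycle-△ _ _ (cap-cycle σ₁ k₁) (cap-cycle σ₂ k₂))
      where
      regroup : ∀ s → (cap σ₁ s xor single σ₁ s) xor (cap σ₂ s xor single σ₂ s) ≡
                      ((cap σ₁ s xor cap σ₂ s) xor single σ₁ s) xor single σ₂ s
      regroup s = trans (interchange (cap σ₁ s) (single σ₁ s) (cap σ₂ s) (single σ₂ s))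
                        (sym (xor-assoc (cap σ₁ s xor cap σ₂ s) (single σ₁ s) (single σ₂ s)))

  fundamentalCut-hypercut : ∀ τ → T τ ≡ true → Hypercut n d (fundamentalCut τ)
  fundamentalCut-hypercut τ Tτ =
    cut⊆K τ ,
    (τ , T⊆K τ Tτ , cong₂ _∧_ (T⊆K τ Tτ) (trans (cap-member τ Tτ τ) (single-self τ))) ,
    fundamentalCut-not-null τ ,
    fundamentalCut-homologous τ Tτ

  module _ (R : NonNegScalars) (w : Subset n → NonNegScalars.Carrier R) where
    open NonNegScalars R

    cutCombination : List (Subset n) → List (Family n × Carrier)
    cutCombination []      = []
    cutCombination (τ ∷ l) =
      if T τ then (fundamentalCut τ , w τ) ∷ cutCombination l else cutCombination l

    cutCombination-hypercuts : ∀ l → AllHypercuts R n d (cutCombination l)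
    cutCombination-hypercuts []      = _
    cutCombination-hypercuts (τ ∷ l) with T τ in Tτ
    ... | true  = fundamentalCut-hypercut τ Tτ , cutCombination-hypercuts l
    ... | false = cutCombination-hypercuts l

    capWeight-decomposition : ∀ σ → K n d σ ≡ true → ∀ l →
      foldr _+_ 0# (map (λ τ → if cap σ τ then w τ else 0#) l) ≡ combination R (cutCombination l) σ
    capWeight-decomposition σ kσ []      = refl
    capWeight-decomposition σ kσ (τ ∷ l) with T τ in Tτ
    ... | true  = cong₂ _+_ (cong (λ b → if b ∧ cap σ τ then w τ else 0#) (sym kσ))
                            (capWeight-decomposition σ kσ l)
    ... | false = begin
      (if cap σ τ then w τ else 0#) + rest  ≡⟨ cong (λ b → (if b then w τ else 0#) + rest) (cap-offT σ τ kσ Tτ) ⟩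
      0# + rest                              ≡⟨ IsCommutativeMonoid.identityˡ isCommutativeMonoid rest ⟩
      rest                                   ≡⟨ capWeight-decomposition σ kσ l ⟩
      combination R (cutCombination l) σ     ∎
      where
      rest : Carrier
      rest = foldr _+_ 0# (map (λ τ′ → if cap σ τ′ then w τ′ else 0#) l)

module InducedCaps (R : NonNegScalars) {n d : ℕ} {X : Family n} {w v : Subset n → NonNegScalars.Carrier R}
                   (induced : IsInducedVolume R n d X w v) where

  capFor : ∀ ρ b → K n d ρ ≡ b → Family n
  capFor ρ true  kρ = proj₁ (proj₁ (induced ρ kρ))
  capFor ρ false _  = empty

  capFor-spec : ∀ ρ b (kρ : K n d ρ ≡ b) → b ≡ true →
                Cap R n d X ρ (capFor ρ b kρ) × v ρ ≡ weight R n d w (capFor ρ b kρ)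
  capFor-spec ρ true kρ _ = proj₂ (proj₁ (induced ρ kρ))

  inducedCap : Subset n → Family n
  inducedCap ρ = capFor ρ (K n d ρ) refl

  inducedCap-spec : ∀ ρ → K n d ρ ≡ true →
                    Cap R n d X ρ (inducedCap ρ) × v ρ ≡ weight R n d w (inducedCap ρ)
  inducedCap-spec ρ = capFor-spec ρ (K n d ρ) refl

mainTheorem3 : (R : NonNegScalars) (n d : ℕ) (T : Family n)
               (w v : Subset n → NonNegScalars.Carrier R) →
               Hypertree n d T →
               IsInducedVolume R n d T w v →
               IsL1Volume R n d v
mainTheorem3 R n d T w v (T⊆K , acyclic , _) induced =
  cutCombination R w (simplices n d) ,
  cutCombination-hypercuts R w (simplices n d) ,
  λ σ kσ → trans (proj₂ (inducedCap-spec σ kσ)) (capWeight-decomposition R w σ kσ (simplices n d))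
  where
  open InducedCaps R induced
  open FundamentalCuts T T⊆K acyclic inducedCap
         (λ ρ kρ → proj₁ (proj₁ (inducedCap-spec ρ kρ)))
         (λ ρ kρ → proj₂ (proj₁ (inducedCap-spec ρ kρ)))
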